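{- Let $P$ be a logic program over $\Sigma$ and $t\in\mathbf{Term}(\Sigma)$. (1) If $\mathrm{rew}(P,?\gets t,\sigma)$ is an inductive success tree for some $\sigma\in\mathbf{Subst}(\Sigma)$, then every ground instance $t'\in\mathbf{GTerm}(\Sigma)$ of $\sigma(t)$ belongs to $M_P$. (2) If $t\in M_P$, then there exists a grounding substitution $\theta\in\mathbf{Subst}(\Sigma)$ such that $\mathrm{rew}(P,?\gets t,\theta)$ is an inductive success tree.
   Context: Terms are finite first-order terms with variables over a signature $\Sigma$ containing at least one constant; $\mathbf{GTerm}(\Sigma)$ is the set of finite ground terms, $\mathbf{Subst}(\Sigma)$ the set of (idempotent) substitutions with finite-term codomain. A clause is $A\gets B_0,\ldots,B_m$ (body possibly empty); a goal clause is $?\gets B_0,\ldots,B_m$; a logic program $P$ is a finite list $P(0),\ldots,P(k)$ of non-goal clauses, viewed as functions on $\{\epsilon,0,\ldots,m\}$ with $C(\epsilon)$ the head, $C(j)=B_j$. $s\prec_\theta u$ means $\theta$ is a most general matcher of $s$ against $u$. Clause variables are renamed apart. $M_P$ (least Herbrand model) is the smallest set of finite ground terms such that whenever $A\gets B_1,\ldots,B_n$ is a clause of $P$, $\sigma$ is grounding, and $\sigma(B_1),\ldots,\sigma(B_n)\in M_P$, then $\sigma(A)\in M_P$. Rewriting tree $T=\mathrm{rew}(P,C,\sigma)$ ($V_R$ a set of or-node variables): $T(\epsilon)=\sigma(C)$, $T(i)=\sigma(C(i))$ for body positions $i$ of $C$; each odd-length node $w$ is a term with, for every clause index $i$ of $P$,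 a child $wi$ labelled $\sigma(\theta(P(i)))$ if $\mathrm{head}(P(i))\prec_\theta T(w)$, else a fresh variable of $V_R$; each even positive-length node is a clause or a variable; variables are leaves; a clause node $\sigma(\theta(P(i)))$ at $w$ has children $wj$ labelled $\sigma(\theta(P(i)(j)))$ for body positions $j$; no other nodes. Even-depth nodes are or-nodes, odd-depth are and-nodes. A rewriting subtree $T'$ of $T$ contains the root, all children of each of its even-depth nodes, and exactly one child of each of its odd-depth nodes (labels as in $T$). An inductive success node is a non-variable leaf or-node. $T$ is an inductive success tree if it has a finite rewriting subtree all of whose leaves are inductive success nodes. -}

module Defs where

open import Data.Nat using (ℕ; zero; suc)
open import Data.Bool using (Bool; true; false; not)
open import Data.List using (List; []; _∷_; length; map)
open import Data.List.Membership.Propositional using (_∈_)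
open import Data.List.Relation.Unary.All using (All)
open import Data.Vec using (Vec; []; _∷_)
open import Data.Product using (Σ; ∃; _×_; _,_)
open import Relation.Binary.PropositionalEquality using (_≡_)
open import Relation.Nullary using (¬_)

record Signature : Set₁ where
  field
    Sym      : Set
    arity    : Sym → ℕ
    hasConst : ∃ λ c → arity c ≡ 0

module _ (Sg : Signature) where
  open Signature Sg

  data Term : Set where
    var : ℕ → Term
    fn  : (f : Sym) → Vec Term (arity f) → Term

  Subst : Set
  Subst = ℕ → Term

  record Clause : Set where
    constructor _⇐_
    field
      head : Term
      body : List Term

  Program : Set
  Program = List Clause

module _ {Sg : Signature} where
  open Signature Sg

  data _occursIn_ (x : ℕ) : Term Sg → Set
  data _occursIn*_ (x : ℕ) : ∀ {n} → Vec (Term Sg) n → Set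

  data _occursIn_ x where
    here  : x occursIn var x
    under : ∀ {f ts} → x occursIn* ts → x occursIn fn f ts

  data _occursIn*_ x where
    hd : ∀ {n t} {ts : Vec (Term Sg) n} → x occursIn t → x occursIn* (t ∷ ts)
    tl : ∀ {n t} {ts : Vec (Term Sg) n} → x occursIn* ts → x occursIn* (t ∷ ts)

  Ground : Term Sg → Set
  Ground t = ∀ x → ¬ (x occursIn t)

  _⟪_⟫  : Subst Sg → Term Sg → Term Sg
  _⟪_⟫* : ∀ {n} → Subst Sg → Vec (Term Sg) n → Vec (Term Sg) n
  σ ⟪ var x ⟫    = σ x
  σ ⟪ fn f ts ⟫  = fn f (σ ⟪ ts ⟫*)
  σ ⟪ [] ⟫*      = []
  σ ⟪ t ∷ ts ⟫*  = σ ⟪ t ⟫ ∷ σ ⟪ ts ⟫*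

  applyClause : Subst Sg → Clause Sg → Clause Sg
  applyClause σ (h ⇐ bs) = (σ ⟪ h ⟫) ⇐ map (σ ⟪_⟫) bs

  -- Subst(Σ): substitutions are idempotent
  Idempotent : Subst Sg → Set
  Idempotent σ = ∀ x → σ ⟪ σ x ⟫ ≡ σ x

  Grounding : Subst Sg → Set
  Grounding σ = ∀ x → Ground (σ x)

  -- s ≺_θ u : θ is a most general matcher of s against u
  -- (θ(s) = u and θ does not touch variables outside s)
  _≺[_]_ : Term Sg → Subst Sg → Term Sg → Set
  s ≺[ θ ] u = (θ ⟪ s ⟫ ≡ u) × (∀ x → ¬ (x occursIn s) → θ x ≡ var x)

  -- Least Herbrand model M_P (inductively: the least set closed under
  -- ground instances of the clauses of P)

  data _∈M[_] : Term Sg → Program Sg → Set where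
    step : ∀ {P : Program Sg} {C : Clause Sg} (σ : Subst Sg) →
           C ∈ P →
           Ground (σ ⟪ Clause.head C ⟫) →
           All (λ b → Ground (σ ⟪ b ⟫)) (Clause.body C) →
           All (λ b → (σ ⟪ b ⟫) ∈M[ P ]) (Clause.body C) →
           (σ ⟪ Clause.head C ⟫) ∈M[ P ]

  data _[_]=_ {A : Set} : List A → ℕ → A → Set where
    here  : ∀ {a as} → (a ∷ as) [ 0 ]= a
    there : ∀ {a b as i} → as [ i ]= b → (a ∷ as) [ suc i ]= b

  -- Tree positions are lists of natural numbers, written *leaf first*:
  -- the child i of position w is  i ∷ w ; the root is [].
  Position : Set
  Position = List ℕ

  -- Renaming of clause variables: the copy of a program clause used at
  -- position p has variable x renamed to  ρ p x.
  Renaming : Set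
  Renaming = Position → ℕ → ℕ

  rename : Renaming → Position → Subst Sg
  rename ρ p x = var (ρ p x)

  RenamedApart : Term Sg → Renaming → Set
  RenamedApart t ρ =
    (∀ p q x y → ρ p x ≡ ρ q y → (p ≡ q) × (x ≡ y)) ×
    (∀ p x → ¬ (ρ p x occursIn t))

  data Label : Set where
    goalL   : List (Term Sg) → Label
    clauseL : Clause Sg → Label
    termL   : Term Sg → Label
    varL    : Label                      -- a (fresh) variable of V_R

  even : ℕ → Bool
  even zero    = true
  even (suc n) = not (even n)

  -- The rewriting tree  rew(P, ? ← gs, σ)  (with renaming ρ), given as the
  -- relation  Node w ℓ : "w is a node of the tree, labelled ℓ".
  module Rew (P : Program Sg) (gs : List (Term Sg)) (σ : Subst Sg) (ρ : Renaming) where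

    data Node : Position → Label → Set where
      root      : Node [] (goalL (map (σ ⟪_⟫) gs))
      goalChild : ∀ {j b} → gs [ j ]= b → Node (j ∷ []) (termL (σ ⟪ b ⟫))
      matchChild : ∀ {w u i C θ} → Node w (termL u) → P [ i ]= C →
        (rename ρ (i ∷ w) ⟪ Clause.head C ⟫) ≺[ θ ] u →
        Node (i ∷ w)
          (clauseL (applyClause (λ x → σ ⟪ θ ⟪ rename ρ (i ∷ w) x ⟫ ⟫) C))
      noMatchChild : ∀ {w u i C} → Node w (termL u) → P [ i ]= C →
        ¬ (∃ λ θ → (rename ρ (i ∷ w) ⟪ Clause.head C ⟫) ≺[ θ ] u) →
        Node (i ∷ w) varL
      bodyChild : ∀ {w C j b} → Node w (clauseL C) → Clause.body C [ j ]= b →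
        Node (j ∷ w) (termL b)

    -- inductive success node: a non-variable leaf or-node (even depth)
    InductiveSuccessNode : Position → Set
    InductiveSuccessNode w =
      even (length w) ≡ true ×
      (∃ λ ℓ → Node w ℓ × ¬ (ℓ ≡ varL)) ×
      (∀ i ℓ → ¬ Node (i ∷ w) ℓ)

    -- a finite rewriting subtree T' of T, given by its (finite) list of
    -- positions S, all of whose leaves are inductive success nodes
    record FiniteSuccessSubtree (S : List Position) : Set where
      field
        hasRoot   : [] ∈ S
        inTree    : ∀ w → w ∈ S → ∃ λ ℓ → Node w ℓ
        connected : ∀ i w → (i ∷ w) ∈ S → w ∈ S
        orAll     : ∀ w → w ∈ S → even (length w) ≡ true →
                    ∀ i ℓ → Node (i ∷ w) ℓ → (i ∷ w) ∈ S
        andOne    : ∀ w → w ∈ S → even (length w) ≡ false →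
                    ∃ λ i → ((i ∷ w) ∈ S) × (∀ j → (j ∷ w) ∈ S → j ≡ i)
        leavesOk  : ∀ w → w ∈ S → (∀ i → ¬ ((i ∷ w) ∈ S)) →
                    InductiveSuccessNode w

    InductiveSuccessTree : Set
    InductiveSuccessTree = ∃ λ S → FiniteSuccessSubtree S

  IndSuccess : Program Sg → Term Sg → Subst Sg → Renaming → Set
  IndSuccess P t σ ρ = Rew.InductiveSuccessTree P (t ∷ []) σ ρ

module Submission where

-- Soundness: call u sound when all ground instances of u lie in M_P.  For
-- idempotent σ each term node u of rew(P, ? ← t, σ) is σ-fixed, so a matching
-- clause child instantiates a program clause with head u, and sound body atoms
-- make u sound (instance-sound).  Induction on the height of a finite success
-- subtree carries soundness from its leaves to the goal atom σ(t).
--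
-- Completeness: a derivation of t ∈ M_P becomes a proof tree, laid out in the
-- rewriting tree (atom at v, clause at i ∷ v, premises at j ∷ i ∷ v).  As the
-- clause copies are renamed apart, one grounding θ is read off a finite table
-- of bindings; the proof nodes are then nodes of rew(P, ? ← t, θ) and their
-- positions form a finite success subtree.

open import Defs
open import Data.Bool using (Bool; true; false; not)
open import Data.Bool.Properties using (not-involutive)
open import Data.Empty using (⊥; ⊥-elim)
open import Data.List using (List; []; _∷_; length; map; _++_; concatMap; foldr)
open import Data.List.Membership.Propositional using (_∈_; find; lose)
open import Data.List.Membership.Propositional.Properties
  using (∈-++⁺ˡ; ∈-++⁺ʳ; ∈-++⁻; ∈-map⁺; ∈-map⁻; ∈-concatMap⁺; ∈-concatMap⁻)
open import Data.List.Properties using (∷-injective; ∷-injectiveʳ; map-cong)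
open import Data.List.Relation.Unary.All using (All; []; _∷_)
import Data.List.Relation.Unary.All as All
open import Data.List.Relation.Unary.All.Properties using (map⁻)
open import Data.List.Relation.Unary.Any using (here; there)
open import Data.Nat using (ℕ; zero; suc; _≤_; _+_; _⊔_; _≟_)
open import Data.Nat.Properties
  using (≤-refl; ≤-trans; m≤m⊔n; m≤n⊔m; m≤m+n; m≤n⇒m≤1+n; n≤1+n; 1+n≰n; +-suc)
open import Data.Product using (Σ; ∃; ∃₂; _×_; _,_; proj₁; proj₂)
open import Data.Sum using (_⊎_; inj₁; inj₂)
open import Data.Unit using (⊤; tt)
open import Data.Vec using (Vec; []; _∷_)
import Data.Vec as Vec
open import Function using (_∘_)
open import Relation.Binary.PropositionalEquality
  using (_≡_; refl; sym; trans; cong; cong₂; subst; module ≡-Reasoning)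
open import Relation.Nullary using (¬_; Dec; yes; no)

open ≡-Reasoning

maxLength : {A : Set} → List (List A) → ℕ
maxLength = foldr (λ w m → length w ⊔ m) 0

length≤maxLength : ∀ {A : Set} {w : List A} {ws} → w ∈ ws → length w ≤ maxLength ws
length≤maxLength {ws = v ∷ vs} (here refl) = m≤m⊔n (length v) (maxLength vs)
length≤maxLength {ws = v ∷ vs} (there p) =
  ≤-trans (length≤maxLength p) (m≤n⊔m (length v) (maxLength vs))

lookupKey : {V : Set} → V → List (ℕ × V) → ℕ → V
lookupKey d [] y = d
lookupKey d ((k , v) ∷ L) y with y ≟ k
... | yes _ = v
... | no _  = lookupKey d L y

lookupKey-∈ : ∀ {V : Set} {d : V} {y v} L → (y , v) ∈ L →
              (∀ {v′} → (y , v′) ∈ L → v′ ≡ v) → lookupKey d L y ≡ v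
lookupKey-∈ {y = y} ((k , v′) ∷ L) y∈L consistent with y ≟ k
... | yes refl = consistent (here refl)
... | no y≢k with y∈L
...   | here eq   = ⊥-elim (y≢k (cong proj₁ eq))
...   | there y∈ = lookupKey-∈ L y∈ (consistent ∘ there)

module Theory (Sg : Signature) where
  open Signature Sg

  _⊚_ : Subst Sg → Subst Sg → Subst Sg
  (σ ⊚ τ) x = σ ⟪ τ x ⟫

  apply-cong  : ∀ {σ τ : Subst Sg} t → (∀ x → x occursIn t → σ x ≡ τ x) → σ ⟪ t ⟫ ≡ τ ⟪ t ⟫
  apply-cong* : ∀ {σ τ : Subst Sg} {n} (ts : Vec (Term Sg) n) →
                (∀ x → x occursIn* ts → σ x ≡ τ x) → σ ⟪ ts ⟫* ≡ τ ⟪ ts ⟫*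
  apply-cong (var x) h   = h x here
  apply-cong (fn f ts) h = cong (fn f) (apply-cong* ts (λ x → h x ∘ under))
  apply-cong* [] h       = refl
  apply-cong* (t ∷ ts) h = cong₂ _∷_ (apply-cong t (λ x → h x ∘ hd)) (apply-cong* ts (λ x → h x ∘ tl))

  apply-⊚  : ∀ σ τ t → σ ⟪ τ ⟪ t ⟫ ⟫ ≡ (σ ⊚ τ) ⟪ t ⟫
  apply-⊚* : ∀ σ τ {n} (ts : Vec (Term Sg) n) → σ ⟪ τ ⟪ ts ⟫* ⟫* ≡ (σ ⊚ τ) ⟪ ts ⟫*
  apply-⊚ σ τ (var x)    = refl
  apply-⊚ σ τ (fn f ts)  = cong (fn f) (apply-⊚* σ τ ts)
  apply-⊚* σ τ []        = refl
  apply-⊚* σ τ (t ∷ ts)  = cong₂ _∷_ (apply-⊚ σ τ t) (apply-⊚* σ τ ts)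

  apply-var  : ∀ t → var ⟪ t ⟫ ≡ t
  apply-var* : ∀ {n} (ts : Vec (Term Sg) n) → var ⟪ ts ⟫* ≡ ts
  apply-var (var x)     = refl
  apply-var (fn f ts)   = cong (fn f) (apply-var* ts)
  apply-var* []         = refl
  apply-var* (t ∷ ts)   = cong₂ _∷_ (apply-var t) (apply-var* ts)

  apply-ground : ∀ σ t → Ground t → σ ⟪ t ⟫ ≡ t
  apply-ground σ t g = trans (apply-cong t (λ x o → ⊥-elim (g x o))) (apply-var t)

  idempotent-apply : ∀ σ → Idempotent σ → ∀ t → σ ⟪ σ ⟪ t ⟫ ⟫ ≡ σ ⟪ t ⟫
  idempotent-apply σ σ-idem t = trans (apply-⊚ σ σ t) (apply-cong t (λ x _ → σ-idem x))

  idempotent-absorbs : ∀ σ → Idempotent σ → ∀ τ t → σ ⟪ (σ ⊚ τ) ⟪ t ⟫ ⟫ ≡ (σ ⊚ τ) ⟪ t ⟫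
  idempotent-absorbs σ σ-idem τ t = begin
    σ ⟪ (σ ⊚ τ) ⟪ t ⟫ ⟫   ≡⟨ cong (σ ⟪_⟫) (sym (apply-⊚ σ τ t)) ⟩
    σ ⟪ σ ⟪ τ ⟪ t ⟫ ⟫ ⟫   ≡⟨ idempotent-apply σ σ-idem (τ ⟪ t ⟫) ⟩
    σ ⟪ τ ⟪ t ⟫ ⟫         ≡⟨ apply-⊚ σ τ t ⟩
    (σ ⊚ τ) ⟪ t ⟫         ∎

  fn-injective : ∀ {f} {us vs : Vec (Term Sg) (arity f)} → fn f us ≡ fn f vs → us ≡ vs
  fn-injective refl = refl

  agree-on-vars  : ∀ {σ τ : Subst Sg} {x} s → σ ⟪ s ⟫ ≡ τ ⟪ s ⟫ → x occursIn s → σ x ≡ τ x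
  agree-on-vars* : ∀ {σ τ : Subst Sg} {x} {n} (ss : Vec (Term Sg) n) →
                   σ ⟪ ss ⟫* ≡ τ ⟪ ss ⟫* → x occursIn* ss → σ x ≡ τ x
  agree-on-vars (var x) e here                = e
  agree-on-vars (fn f ts) e (under o)         = agree-on-vars* ts (fn-injective e) o
  agree-on-vars* (t ∷ ts) e (hd o) = agree-on-vars t (cong Vec.head e) o
  agree-on-vars* (t ∷ ts) e (tl o) = agree-on-vars* ts (cong Vec.tail e) o

  occurs-apply⁻  : ∀ σ {y} t → y occursIn (σ ⟪ t ⟫) → ∃ λ x → x occursIn t × y occursIn σ x
  occurs-apply⁻* : ∀ σ {y} {n} (ts : Vec (Term Sg) n) → y occursIn* (σ ⟪ ts ⟫*) →
                   ∃ λ x → x occursIn* ts × y occursIn σ x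
  occurs-apply⁻ σ (var x) o = x , here , o
  occurs-apply⁻ σ (fn f ts) (under o) with occurs-apply⁻* σ ts o
  ... | x , p , q = x , under p , q
  occurs-apply⁻* σ (t ∷ ts) (hd o) with occurs-apply⁻ σ t o
  ... | x , p , q = x , hd p , q
  occurs-apply⁻* σ (t ∷ ts) (tl o) with occurs-apply⁻* σ ts o
  ... | x , p , q = x , tl p , q

  occurs-apply  : ∀ σ {x y} t → x occursIn t → y occursIn σ x → y occursIn (σ ⟪ t ⟫)
  occurs-apply* : ∀ σ {x y} {n} (ts : Vec (Term Sg) n) → x occursIn* ts → y occursIn σ x →
                  y occursIn* (σ ⟪ ts ⟫*)
  occurs-apply σ (var x) here o           = o
  occurs-apply σ (fn f ts) (under p) o    = under (occurs-apply* σ ts p o)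
  occurs-apply* σ (t ∷ ts) (hd p) o       = hd (occurs-apply σ t p o)
  occurs-apply* σ (t ∷ ts) (tl p) o       = tl (occurs-apply* σ ts p o)

  ground-at : ∀ σ {x} t → Ground (σ ⟪ t ⟫) → x occursIn t → Ground (σ x)
  ground-at σ t g o y o′ = g y (occurs-apply σ t o o′)

  grounding-apply : ∀ σ → Grounding σ → ∀ t → Ground (σ ⟪ t ⟫)
  grounding-apply σ σ-ground t y o with occurs-apply⁻ σ t o
  ... | x , _ , o′ = σ-ground x y o′

  grounding-idempotent : ∀ σ → Grounding σ → Idempotent σ
  grounding-idempotent σ σ-ground x = apply-ground σ (σ x) (σ-ground x)

  ⊚-grounding : ∀ σ τ → Grounding σ → Grounding (σ ⊚ τ)
  ⊚-grounding σ τ σ-ground x = grounding-apply σ σ-ground (τ x)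

  occurs? : ∀ x t → Dec (x occursIn t)
  occurs*? : ∀ x {n} (ts : Vec (Term Sg) n) → Dec (x occursIn* ts)
  occurs? x (var y) with x ≟ y
  ... | yes refl = yes here
  ... | no x≢y   = no λ { here → x≢y refl }
  occurs? x (fn f ts) with occurs*? x ts
  ... | yes o = yes (under o)
  ... | no ¬o = no λ { (under o) → ¬o o }
  occurs*? x [] = no λ ()
  occurs*? x (t ∷ ts) with occurs? x t | occurs*? x ts
  ... | yes o | _      = yes (hd o)
  ... | no _  | yes o  = yes (tl o)
  ... | no ¬o | no ¬os = no λ { (hd o) → ¬o o ; (tl o) → ¬os o }

  matcher-unique : ∀ {s u : Term Sg} {θ₁ θ₂} → s ≺[ θ₁ ] u → s ≺[ θ₂ ] u → ∀ x → θ₁ x ≡ θ₂ x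
  matcher-unique {s} (e₁ , out₁) (e₂ , out₂) x with occurs? x s
  ... | yes o = agree-on-vars s (trans e₁ (sym e₂)) o
  ... | no ¬o = trans (out₁ x ¬o) (sym (out₂ x ¬o))

  restrict : Term Sg → Subst Sg → Subst Sg
  restrict s θ y with occurs? y s
  ... | yes _ = θ y
  ... | no _  = var y

  restrict-matches : ∀ s θ → s ≺[ restrict s θ ] (θ ⟪ s ⟫)
  restrict-matches s θ = apply-cong s inside , outside
    where
      inside : ∀ y → y occursIn s → restrict s θ y ≡ θ y
      inside y o with occurs? y s
      ... | yes _ = refl
      ... | no ¬o = ⊥-elim (¬o o)
      outside : ∀ y → ¬ (y occursIn s) → restrict s θ y ≡ var y
      outside y ¬o with occurs? y s
      ... | yes o = ⊥-elim (¬o o)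
      ... | no _  = refl

  restrict-absorbed : ∀ θ → Idempotent θ → ∀ s y → (θ ⊚ restrict s θ) y ≡ θ y
  restrict-absorbed θ θ-idem s y with occurs? y s
  ... | yes _ = θ-idem y
  ... | no _  = refl

  applyClause-cong : ∀ {σ τ : Subst Sg} → (∀ x → σ x ≡ τ x) → ∀ C → applyClause σ C ≡ applyClause τ C
  applyClause-cong h (hd′ ⇐ bs) =
    cong₂ _⇐_ (apply-cong hd′ (λ x _ → h x)) (map-cong (λ b → apply-cong b (λ x _ → h x)) bs)

  emptyArgs : ∀ {n} → n ≡ 0 → Vec (Term Sg) n
  emptyArgs refl = []

  emptyArgs-closed : ∀ {x n} (e : n ≡ 0) → ¬ (x occursIn* emptyArgs e)
  emptyArgs-closed refl ()

  constant : Term Sg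
  constant = fn (proj₁ hasConst) (emptyArgs (proj₂ hasConst))

  grounder : Subst Sg
  grounder _ = constant

  grounder-grounding : Grounding grounder
  grounder-grounding _ x (under o) = emptyArgs-closed (proj₂ hasConst) o

  -- List indexing: the relation _[_]=_ of Defs with its signature fixed.  It
  -- is functional, agrees with membership, commutes with map and reads All.
  _[_]↦_ : {A : Set} → List A → ℕ → A → Set
  xs [ i ]↦ a = _[_]=_ {Sg} xs i a

  ↦-functional : ∀ {A : Set} {xs : List A} {i a b} → xs [ i ]↦ a → xs [ i ]↦ b → a ≡ b
  ↦-functional here here           = refl
  ↦-functional (there p) (there q) = ↦-functional p q

  ↦-∈ : ∀ {A : Set} {xs : List A} {i a} → xs [ i ]↦ a → a ∈ xs
  ↦-∈ here      = here refl
  ↦-∈ (there p) = there (↦-∈ p)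

  ∈-↦ : ∀ {A : Set} {xs : List A} {a} → a ∈ xs → ∃ λ i → xs [ i ]↦ a
  ∈-↦ (here refl) = 0 , here
  ∈-↦ (there p) with ∈-↦ p
  ... | i , q = suc i , there q

  map-↦ : ∀ {A B : Set} (f : A → B) {xs j x} → xs [ j ]↦ x → map f xs [ j ]↦ f x
  map-↦ f here      = here
  map-↦ f (there q) = there (map-↦ f q)

  map-↦⁻ : ∀ {A B : Set} (f : A → B) (xs : List A) {j y} → map f xs [ j ]↦ y →
           ∃ λ x → xs [ j ]↦ x × y ≡ f x
  map-↦⁻ f (x ∷ xs) here = x , here , refl
  map-↦⁻ f (x ∷ xs) (there p) with map-↦⁻ f xs p
  ... | z , q , e = z , there q , e

  All-↦ : ∀ {A : Set} {Q : A → Set} {xs j b} → All Q xs → xs [ j ]↦ b → Q b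
  All-↦ (p ∷ ps) here      = p
  All-↦ (p ∷ ps) (there q) = All-↦ ps q

  All-from-↦ : ∀ {A : Set} {Q : A → Set} (xs : List A) → (∀ {j b} → xs [ j ]↦ b → Q b) → All Q xs
  All-from-↦ []       h = []
  All-from-↦ (x ∷ xs) h = h here ∷ All-from-↦ xs (h ∘ there)

  ev : ℕ → Bool
  ev = even {Sg}

  module RewFacts (P : Program Sg) (gs : List (Term Sg)) (σ : Subst Sg) (ρ : Renaming {Sg}) where
    open Rew P gs σ ρ

    node-functional : ∀ {w ℓ₁ ℓ₂} → Node w ℓ₁ → Node w ℓ₂ → ℓ₁ ≡ ℓ₂
    node-functional root root = refl
    node-functional (goalChild p) (goalChild q) = cong (λ b → termL (σ ⟪ b ⟫)) (↦-functional p q)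
    node-functional (goalChild _) (matchChild () _ _)
    node-functional (goalChild _) (noMatchChild () _ _)
    node-functional (goalChild _) (bodyChild () _)
    node-functional (matchChild () _ _) (goalChild _)
    node-functional (noMatchChild () _ _) (goalChild _)
    node-functional (bodyChild () _) (goalChild _)
    node-functional (matchChild {C = C} n₁ p₁ m₁) (matchChild n₂ p₂ m₂)
      with node-functional n₁ n₂ | ↦-functional p₁ p₂
    ... | refl | refl = cong clauseL (applyClause-cong (λ x → cong (σ ⟪_⟫) (matcher-unique m₁ m₂ _)) C)
    node-functional (matchChild n₁ p₁ m₁) (noMatchChild n₂ p₂ ¬m)
      with node-functional n₁ n₂ | ↦-functional p₁ p₂
    ... | refl | refl = ⊥-elim (¬m (_ , m₁))
    node-functional (noMatchChild n₁ p₁ ¬m) (matchChild n₂ p₂ m₂)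
      with node-functional n₁ n₂ | ↦-functional p₁ p₂
    ... | refl | refl = ⊥-elim (¬m (_ , m₂))
    node-functional (noMatchChild _ _ _) (noMatchChild _ _ _) = refl
    node-functional (matchChild n₁ _ _) (bodyChild n₂ _) with node-functional n₁ n₂
    ... | ()
    node-functional (noMatchChild n₁ _ _) (bodyChild n₂ _) with node-functional n₁ n₂
    ... | ()
    node-functional (bodyChild n₁ _) (matchChild n₂ _ _) with node-functional n₁ n₂
    ... | ()
    node-functional (bodyChild n₁ _) (noMatchChild n₂ _ _) with node-functional n₁ n₂
    ... | ()
    node-functional (bodyChild n₁ q₁) (bodyChild n₂ q₂) with node-functional n₁ n₂
    ... | refl = cong termL (↦-functional q₁ q₂)

    term-depth   : ∀ {w u} → Node w (termL u) → ev (length w) ≡ false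
    clause-depth : ∀ {w C} → Node w (clauseL C) → ev (length w) ≡ true
    term-depth (goalChild _)      = refl
    term-depth (bodyChild n _)    = cong not (clause-depth n)
    clause-depth (matchChild n _ _) = cong not (term-depth n)

    root-not-term : ∀ {u} → ¬ Node [] (termL u)
    root-not-term ()

    variable-leaf : ∀ {w i ℓ} → Node w varL → ¬ Node (i ∷ w) ℓ
    variable-leaf n (goalChild _) with n
    ... | ()
    variable-leaf n (matchChild m _ _) with node-functional n m
    ... | ()
    variable-leaf n (noMatchChild m _ _) with node-functional n m
    ... | ()
    variable-leaf n (bodyChild m _) with node-functional n m
    ... | ()

  Sound : Program Sg → Term Sg → Set
  Sound P u = ∀ τ → Ground (τ ⟪ u ⟫) → (τ ⟪ u ⟫) ∈M[ P ]

  -- The rule defining M_P, for sound terms: if g instantiates the i-th clause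
  -- of P so that its head becomes u and its body atoms are sound, u is sound.
  -- (A ground instance τ(u) is derived via the clause instance grounder ⊚ τ ⊚ g.)
  instance-sound : ∀ {P i C} (g : Subst Sg) {u} → P [ i ]↦ C → g ⟪ Clause.head C ⟫ ≡ u →
                   All (Sound P) (map (g ⟪_⟫) (Clause.body C)) → Sound P u
  instance-sound {P} {C = h ⇐ bs} g {u} C∈P head-eq body-sound τ τu-ground =
    subst (_∈M[ P ]) head-instance
      (step σ′ (↦-∈ C∈P) (grounding-apply σ′ σ′-grounding h)
        (All.tabulate (λ {b} _ → grounding-apply σ′ σ′-grounding b))
        (All.map (λ {b} → premise {b}) (map⁻ body-sound)))
    where
      τ′ : Subst Sg
      τ′ = grounder ⊚ τ
      τ′-grounding : Grounding τ′
      τ′-grounding = ⊚-grounding grounder τ grounder-grounding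
      σ′ : Subst Sg
      σ′ = τ′ ⊚ g
      σ′-grounding : Grounding σ′
      σ′-grounding = ⊚-grounding τ′ g τ′-grounding
      head-instance : σ′ ⟪ h ⟫ ≡ τ ⟪ u ⟫
      head-instance = begin
        σ′ ⟪ h ⟫                 ≡⟨ sym (apply-⊚ τ′ g h) ⟩
        τ′ ⟪ g ⟪ h ⟫ ⟫           ≡⟨ cong (τ′ ⟪_⟫) head-eq ⟩
        τ′ ⟪ u ⟫                 ≡⟨ sym (apply-⊚ grounder τ u) ⟩
        grounder ⟪ τ ⟪ u ⟫ ⟫     ≡⟨ apply-ground grounder _ τu-ground ⟩
        τ ⟪ u ⟫                  ∎
      premise : ∀ {b} → Sound P (g ⟪ b ⟫) → (σ′ ⟪ b ⟫) ∈M[ P ]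
      premise {b} b-sound =
        subst (_∈M[ P ]) (apply-⊚ τ′ g b) (b-sound τ′ (grounding-apply τ′ τ′-grounding (g ⟪ b ⟫)))

  module Soundness (P : Program Sg) (t : Term Sg) (σ : Subst Sg) (ρ : Renaming {Sg})
                   (σ-idem : Idempotent σ) where
    open Rew P (t ∷ []) σ ρ
    open RewFacts P (t ∷ []) σ ρ

    SoundLabel : Label {Sg} → Set
    SoundLabel (termL u)   = Sound P u
    SoundLabel (clauseL C) = All (Sound P) (Clause.body C)
    SoundLabel _           = ⊤

    SoundAt : Position {Sg} → Set
    SoundAt w = ∀ {ℓ} → Node w ℓ → SoundLabel ℓ

    term-fixed : ∀ {w u} → Node w (termL u) → σ ⟪ u ⟫ ≡ u
    term-fixed (goalChild {b = b} _) = idempotent-apply σ σ-idem b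
    term-fixed (bodyChild (matchChild {w = w} {i = i} {C = C} {θ = θ} _ _ _) q)
      with map-↦⁻ ((σ ⊚ (θ ⊚ rename ρ (i ∷ w))) ⟪_⟫) (Clause.body C) q
    ... | b , _ , refl = idempotent-absorbs σ σ-idem (θ ⊚ rename ρ (i ∷ w)) b

    match-sound : ∀ {w u i C θ} → Node w (termL u) → P [ i ]↦ C →
                  (rename ρ (i ∷ w) ⟪ Clause.head C ⟫) ≺[ θ ] u →
                  SoundLabel (clauseL (applyClause (σ ⊚ (θ ⊚ rename ρ (i ∷ w))) C)) → Sound P u
    match-sound {w} {u} {i} {h ⇐ bs} {θ} nd C∈P (matches , _) =
      instance-sound (σ ⊚ (θ ⊚ r)) C∈P head-eq
      where
        r : Subst Sg
        r = rename ρ (i ∷ w)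
        head-eq : (σ ⊚ (θ ⊚ r)) ⟪ h ⟫ ≡ u
        head-eq = begin
          (σ ⊚ (θ ⊚ r)) ⟪ h ⟫     ≡⟨ sym (apply-⊚ σ (θ ⊚ r) h) ⟩
          σ ⟪ (θ ⊚ r) ⟪ h ⟫ ⟫     ≡⟨ cong (σ ⟪_⟫) (sym (apply-⊚ θ r h)) ⟩
          σ ⟪ θ ⟪ r ⟪ h ⟫ ⟫ ⟫     ≡⟨ cong (σ ⟪_⟫) matches ⟩
          σ ⟪ u ⟫                 ≡⟨ term-fixed nd ⟩
          u                       ∎

    module _ (S : List (Position {Sg})) (T′ : FiniteSuccessSubtree S) where
      open FiniteSuccessSubtree T′

      -- A term node has one child in T′; it cannot be a variable (that would be
      -- a variable leaf), so it is a matching clause node.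
      sound-from-children : ∀ w → w ∈ S → (∀ i → (i ∷ w) ∈ S → SoundAt (i ∷ w)) → SoundAt w
      sound-from-children w w∈S children {termL u} nd with andOne w w∈S (term-depth nd)
      ... | i , i∈S , _ with inTree (i ∷ w) i∈S
      ... | _ , goalChild _ = ⊥-elim (root-not-term nd)
      ... | _ , bodyChild nd′ _ with node-functional nd′ nd
      ...   | ()
      sound-from-children w w∈S children {termL u} nd | i , i∈S , _ | _ , matchChild nd′ C∈P m
        with node-functional nd′ nd
      ...   | refl = match-sound nd C∈P m (children i i∈S (matchChild nd′ C∈P m))
      sound-from-children w w∈S children {termL u} nd | i , i∈S , _ | _ , noMatchChild nd′ C∈P ¬m
        with leavesOk (i ∷ w) i∈S
               (λ k k∈S → variable-leaf (noMatchChild nd′ C∈P ¬m) (proj₂ (inTree _ k∈S)))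
      ... | _ , (_ , nd″ , not-var) , _ =
        ⊥-elim (not-var (node-functional nd″ (noMatchChild nd′ C∈P ¬m)))
      sound-from-children w w∈S children {clauseL C} nd =
        All-from-↦ (Clause.body C) λ q →
          children _ (orAll w w∈S (clause-depth nd) _ _ (bodyChild nd q)) (bodyChild nd q)
      sound-from-children w w∈S children {goalL _} nd = tt
      sound-from-children w w∈S children {varL} nd    = tt

      sound-above : ∀ k w → w ∈ S → maxLength S ≤ k + length w → SoundAt w
      sound-above zero w w∈S bound = sound-from-children w w∈S λ i i∈S →
        ⊥-elim (1+n≰n (≤-trans (length≤maxLength i∈S) bound))
      sound-above (suc k) w w∈S bound = sound-from-children w w∈S λ i i∈S →
        sound-above k (i ∷ w) i∈S (subst (maxLength S ≤_) (sym (+-suc k (length w))) bound)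

    soundness : IndSuccess P t σ ρ → Sound P (σ ⟪ t ⟫)
    soundness (S , T′) =
      sound-above S T′ (maxLength S) (0 ∷ []) goal∈S (m≤m+n (maxLength S) 1) (goalChild here)
      where
        open FiniteSuccessSubtree T′ using (orAll; hasRoot)
        goal∈S : (0 ∷ []) ∈ S
        goal∈S = orAll [] hasRoot refl 0 _ (goalChild here)

  _occursInClause_ : ℕ → Clause Sg → Set
  x occursInClause C =
    (x occursIn Clause.head C) ⊎ (∃₂ λ j b → Clause.body C [ j ]↦ b × x occursIn b)

  vars  : Term Sg → List ℕ
  vars* : ∀ {n} → Vec (Term Sg) n → List ℕ
  vars (var x)    = x ∷ []
  vars (fn f ts)  = vars* ts
  vars* []        = []
  vars* (t ∷ ts)  = vars t ++ vars* ts

  vars-complete  : ∀ {x} t → x occursIn t → x ∈ vars t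
  vars*-complete : ∀ {x n} (ts : Vec (Term Sg) n) → x occursIn* ts → x ∈ vars* ts
  vars-complete (var x) here          = here refl
  vars-complete (fn f ts) (under o)   = vars*-complete ts o
  vars*-complete (t ∷ ts) (hd o)      = ∈-++⁺ˡ (vars-complete t o)
  vars*-complete (t ∷ ts) (tl o)      = ∈-++⁺ʳ (vars t) (vars*-complete ts o)

  clauseVars : Clause Sg → List ℕ
  clauseVars C = vars (Clause.head C) ++ concatMap vars (Clause.body C)

  clauseVars-complete : ∀ {x} C → x occursInClause C → x ∈ clauseVars C
  clauseVars-complete C (inj₁ o) = ∈-++⁺ˡ (vars-complete _ o)
  clauseVars-complete C (inj₂ (_ , b , q , o)) =
    ∈-++⁺ʳ (vars (Clause.head C)) (∈-concatMap⁺ vars (lose (↦-∈ q) (vars-complete b o)))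

  module ProofTrees (P : Program Sg) where

    data ProofTree : Set where
      node : (u : Term Sg) (i : ℕ) (C : Clause Sg) (σ : Subst Sg) (premises : List ProofTree) →
             ProofTree

    conclusion : ProofTree → Term Sg
    conclusion (node u _ _ _ _) = u

    index : ProofTree → ℕ
    index (node _ i _ _ _) = i

    clause : ProofTree → Clause Sg
    clause (node _ _ C _ _) = C

    instantiation : ProofTree → Subst Sg
    instantiation (node _ _ _ σ _) = σ

    premises : ProofTree → List ProofTree
    premises (node _ _ _ _ ks) = ks

    data WellFormed : ProofTree → Set
    data PremisesFit (σ : Subst Sg) : List (Term Sg) → List ProofTree → Set

    data WellFormed where
      wf : ∀ {i C σ ks} → P [ i ]↦ C → Ground (σ ⟪ Clause.head C ⟫) →
           All (λ b → Ground (σ ⟪ b ⟫)) (Clause.body C) → PremisesFit σ (Clause.body C) ks →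
           WellFormed (node (σ ⟪ Clause.head C ⟫) i C σ ks)

    data PremisesFit σ where
      []  : PremisesFit σ [] []
      _∷_ : ∀ {b bs k ks} → conclusion k ≡ σ ⟪ b ⟫ × WellFormed k → PremisesFit σ bs ks →
            PremisesFit σ (b ∷ bs) (k ∷ ks)

    proof-tree    : ∀ {u} → u ∈M[ P ] → Σ ProofTree λ d → WellFormed d × conclusion d ≡ u
    premise-trees : ∀ σ bs → All (λ b → (σ ⟪ b ⟫) ∈M[ P ]) bs → Σ (List ProofTree) (PremisesFit σ bs)
    proof-tree (step {C = C} σ C∈P head-ground body-ground derivations)
      with ∈-↦ C∈P | premise-trees σ (Clause.body C) derivations
    ... | i , C↦ | ks , fit = node _ i C σ ks , wf C↦ head-ground body-ground fit , refl
    premise-trees σ [] [] = [] , []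
    premise-trees σ (b ∷ bs) (m ∷ ms) with proof-tree m | premise-trees σ bs ms
    ... | k , k-wf , concl | ks , fit = k ∷ ks , (concl , k-wf) ∷ fit

    wf-index : ∀ {e} → WellFormed e → P [ index e ]↦ clause e
    wf-index (wf C∈P _ _ _) = C∈P

    wf-conclusion : ∀ {e} → WellFormed e → conclusion e ≡ instantiation e ⟪ Clause.head (clause e) ⟫
    wf-conclusion (wf _ _ _ _) = refl

    wf-conclusion-ground : ∀ {e} → WellFormed e → Ground (conclusion e)
    wf-conclusion-ground (wf _ head-ground _ _) = head-ground

    wf-premises : ∀ {e} → WellFormed e → PremisesFit (instantiation e) (Clause.body (clause e)) (premises e)
    wf-premises (wf _ _ _ fit) = fit

    fit-premise : ∀ {σ bs ks j k} → PremisesFit σ bs ks → ks [ j ]↦ k →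
                  WellFormed k × ∃ λ b → bs [ j ]↦ b × conclusion k ≡ σ ⟪ b ⟫
    fit-premise ((concl , k-wf) ∷ _) here = k-wf , _ , here , concl
    fit-premise (_ ∷ fit) (there q) with fit-premise fit q
    ... | k-wf , b , qb , concl = k-wf , b , there qb , concl

    fit-body : ∀ {σ bs ks j b} → PremisesFit σ bs ks → bs [ j ]↦ b → ∃ λ k → ks [ j ]↦ k
    fit-body (_ ∷ _) here = _ , here
    fit-body (_ ∷ fit) (there q) with fit-body fit q
    ... | k , qk = k , there qk

    wf-instance-ground : ∀ {e x} → WellFormed e → x occursInClause clause e → Ground (instantiation e x)
    wf-instance-ground {node _ _ C σ _} (wf _ head-ground _ _) (inj₁ o) =
      ground-at σ (Clause.head C) head-ground o
    wf-instance-ground (wf _ _ body-ground _) (inj₂ (_ , b , q , o)) =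
      ground-at _ b (All-↦ body-ground q) o

    data SubtreeAt (d : ProofTree) (w : Position {Sg}) : ProofTree → Position {Sg} → Set where
      top  : SubtreeAt d w d w
      down : ∀ {e v j e′ v′} → SubtreeAt d w e v → premises e [ j ]↦ e′ → v′ ≡ j ∷ index e ∷ v →
             SubtreeAt d w e′ v′

    wf-at : ∀ {d w e v} → WellFormed d → SubtreeAt d w e v → WellFormed e
    wf-at d-wf top = d-wf
    wf-at d-wf (down s q refl) = proj₁ (fit-premise (wf-premises (wf-at d-wf s)) q)

    lift : ∀ {d w j k e v} → premises d [ j ]↦ k → SubtreeAt k (j ∷ index d ∷ w) e v → SubtreeAt d w e v
    lift q top            = down top q refl
    lift q (down s q′ eq) = down (lift q s) q′ eq

    subtree-deeper : ∀ {d w e v} → SubtreeAt d w e v → length w ≤ length v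
    subtree-deeper top              = ≤-refl
    subtree-deeper (down s _ refl)  = m≤n⇒m≤1+n (m≤n⇒m≤1+n (subtree-deeper s))

    subtree-parity : ∀ {d w e v} → SubtreeAt d w e v → ev (length v) ≡ ev (length w)
    subtree-parity top = refl
    subtree-parity (down {v = v} s _ refl) = trans (not-involutive (ev (length v))) (subtree-parity s)

    subtree-unique : ∀ {d w e e′ v v′} → SubtreeAt d w e v → SubtreeAt d w e′ v′ → v ≡ v′ → e ≡ e′
    subtree-unique top top _ = refl
    subtree-unique top (down s _ refl) eq =
      ⊥-elim (too-deep (subst (_≤ _) (cong length eq) (subtree-deeper s)))
      where
        too-deep : ∀ {n} → suc (suc n) ≤ n → ⊥
        too-deep {n} p = 1+n≰n (≤-trans (n≤1+n (suc n)) p)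
    subtree-unique (down s q refl) top eq = sym (subtree-unique top (down s q refl) (sym eq))
    subtree-unique (down s₁ q₁ refl) (down s₂ q₂ refl) eq with ∷-injective eq
    ... | refl , eq′ with subtree-unique s₁ s₂ (∷-injectiveʳ eq′)
    ...   | refl = ↦-functional q₁ q₂

    subtrees  : ProofTree → Position {Sg} → List (ProofTree × Position {Sg})
    subtrees* : List ProofTree → (ℕ → Position {Sg}) → List (ProofTree × Position {Sg})
    subtrees (node u i C σ ks) w = (node u i C σ ks , w) ∷ subtrees* ks (λ j → j ∷ i ∷ w)
    subtrees* [] f       = []
    subtrees* (k ∷ ks) f = subtrees k (f 0) ++ subtrees* ks (f ∘ suc)

    subtrees*-⊇ : ∀ {ks f j k x} → ks [ j ]↦ k → x ∈ subtrees k (f j) → x ∈ subtrees* ks f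
    subtrees*-⊇ here m = ∈-++⁺ˡ m
    subtrees*-⊇ {k′ ∷ ks} {f} (there q) m = ∈-++⁺ʳ (subtrees k′ (f 0)) (subtrees*-⊇ {ks} {f ∘ suc} q m)

    subtrees-complete : ∀ {d w e v} → SubtreeAt d w e v → (e , v) ∈ subtrees d w
    subtrees-complete s = mono s (self _ _)
      where
        self : ∀ e v → (e , v) ∈ subtrees e v
        self (node _ _ _ _ _) v = here refl
        mono : ∀ {d w e v x} → SubtreeAt d w e v → x ∈ subtrees e v → x ∈ subtrees d w
        mono top m = m
        mono (down {e = node _ _ _ _ _} s q refl) m = mono s (there (subtrees*-⊇ q m))

    subtrees-sound  : ∀ d w {e v} → (e , v) ∈ subtrees d w → SubtreeAt d w e v
    subtrees*-sound : ∀ ks f {e v} → (e , v) ∈ subtrees* ks f →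
                      ∃₂ λ j k → ks [ j ]↦ k × SubtreeAt k (f j) e v
    subtrees-sound (node _ _ _ _ _) w (here refl) = top
    subtrees-sound (node _ i _ _ ks) w (there m) with subtrees*-sound ks (λ j → j ∷ i ∷ w) m
    ... | j , k , q , s = lift q s
    subtrees*-sound (k ∷ ks) f m with ∈-++⁻ (subtrees k (f 0)) m
    ... | inj₁ m′ = 0 , k , here , subtrees-sound k (f 0) m′
    ... | inj₂ m′ with subtrees*-sound ks (f ∘ suc) m′
    ...   | j , k′ , q , s = suc j , k′ , there q , s

    occupied : ProofTree × Position {Sg} → List (Position {Sg})
    occupied (e , v) = v ∷ (index e ∷ v) ∷ []

    positions : ProofTree → Position {Sg} → List (Position {Sg})
    positions d w = concatMap occupied (subtrees d w)

    atom-position : ∀ {d w e v} → SubtreeAt d w e v → v ∈ positions d w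
    atom-position s = ∈-concatMap⁺ occupied (lose (subtrees-complete s) (here refl))

    clause-position : ∀ {d w e v} → SubtreeAt d w e v → (index e ∷ v) ∈ positions d w
    clause-position s = ∈-concatMap⁺ occupied (lose (subtrees-complete s) (there (here refl)))

    positions-inv : ∀ d w {u} → u ∈ positions d w →
                    ∃₂ λ e v → SubtreeAt d w e v × (u ≡ v ⊎ u ≡ index e ∷ v)
    positions-inv d w m with find (∈-concatMap⁻ occupied m)
    ... | (e , v) , ev∈ , here eq         = e , v , subtrees-sound d w ev∈ , inj₁ eq
    ... | (e , v) , ev∈ , there (here eq) = e , v , subtrees-sound d w ev∈ , inj₂ eq

  module Completeness (P : Program Sg) (ρ : Renaming {Sg})
                      (ρ-injective : ∀ p q x y → ρ p x ≡ ρ q y → (p ≡ q) × (x ≡ y))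
                      (t : Term Sg) where
    open ProofTrees P

    renamingAt : ProofTree → Position {Sg} → Subst Sg
    renamingAt e v = rename ρ (index e ∷ v)

    bindings : ProofTree × Position {Sg} → List (ℕ × Term Sg)
    bindings (e , v) = map (λ x → ρ (index e ∷ v) x , instantiation e x) (clauseVars (clause e))

    table : ProofTree → Position {Sg} → List (ℕ × Term Sg)
    table d w = concatMap bindings (subtrees d w)

    binding-∈ : ∀ {d w e v x} → SubtreeAt d w e v → x occursInClause clause e →
                (ρ (index e ∷ v) x , instantiation e x) ∈ table d w
    binding-∈ {e = e} s o =
      ∈-concatMap⁺ bindings (lose (subtrees-complete s) (∈-map⁺ _ (clauseVars-complete (clause e) o)))

    table-inv : ∀ d w {k a} → (k , a) ∈ table d w →
                ∃₂ λ e v → SubtreeAt d w e v × ∃ λ x → k ≡ ρ (index e ∷ v) x × a ≡ instantiation e x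
    table-inv d w m with find (∈-concatMap⁻ bindings m)
    ... | (e , v) , ev∈ , b∈ with ∈-map⁻ _ b∈
    ...   | x , _ , refl = e , v , subtrees-sound d w ev∈ , x , refl , refl

    -- Renaming apart makes the table functional: equal keys come from the same
    -- variable of the same subtree.
    table-functional : ∀ d w {k a a′} → (k , a) ∈ table d w → (k , a′) ∈ table d w → a′ ≡ a
    table-functional d w m m′ with table-inv d w m | table-inv d w m′
    ... | e , v , s , x , refl , refl | e′ , v′ , s′ , x′ , same-key , refl
      with ρ-injective _ _ _ _ same-key
    ...   | same-position , refl with subtree-unique s s′ (∷-injectiveʳ same-position)
    ...     | refl = refl

    module Embedding (d : ProofTree) (d-wf : WellFormed d) (d-concl : conclusion d ≡ t) where
      goal-pos : Position {Sg}
      goal-pos = 0 ∷ []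

      Placed : ProofTree → Position {Sg} → Set
      Placed = SubtreeAt d goal-pos

      placed-parity : ∀ {e v} → Placed e v → ev (length v) ≡ false
      placed-parity = subtree-parity

      θ : Subst Sg
      θ y = grounder ⟪ lookupKey constant (table d goal-pos) y ⟫

      θ-grounding : Grounding θ
      θ-grounding y = grounding-apply grounder grounder-grounding (lookupKey constant (table d goal-pos) y)

      θ-idempotent : Idempotent θ
      θ-idempotent = grounding-idempotent θ θ-grounding

      θ-renamed : ∀ {e v x} → Placed e v → x occursInClause clause e →
                  θ (ρ (index e ∷ v) x) ≡ instantiation e x
      θ-renamed {e} {v} {x} s o = begin
        θ (ρ (index e ∷ v) x)
          ≡⟨ cong (grounder ⟪_⟫) (lookupKey-∈ _ entry (table-functional d goal-pos entry)) ⟩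
        grounder ⟪ instantiation e x ⟫
          ≡⟨ apply-ground grounder _ (wf-instance-ground (wf-at d-wf s) o) ⟩
        instantiation e x
          ∎
        where
          entry : (ρ (index e ∷ v) x , instantiation e x) ∈ table d goal-pos
          entry = binding-∈ s o

      matcher : ProofTree → Position {Sg} → Subst Sg
      matcher e v = restrict (renamingAt e v ⟪ Clause.head (clause e) ⟫) θ

      head-matches : ∀ {e v} → Placed e v →
                     (renamingAt e v ⟪ Clause.head (clause e) ⟫) ≺[ matcher e v ] conclusion e
      head-matches {e} {v} s =
        subst ((renamingAt e v ⟪ h ⟫) ≺[ matcher e v ]_) renamed-head (restrict-matches (renamingAt e v ⟪ h ⟫) θ)
        where
          h : Term Sg
          h = Clause.head (clause e)
          renamed-head : θ ⟪ renamingAt e v ⟪ h ⟫ ⟫ ≡ conclusion e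
          renamed-head = begin
            θ ⟪ renamingAt e v ⟪ h ⟫ ⟫    ≡⟨ apply-⊚ θ (renamingAt e v) h ⟩
            (θ ⊚ renamingAt e v) ⟪ h ⟫    ≡⟨ apply-cong h (λ x o → θ-renamed s (inj₁ o)) ⟩
            instantiation e ⟪ h ⟫         ≡⟨ sym (wf-conclusion (wf-at d-wf s)) ⟩
            conclusion e                  ∎

      clauseSubst : ProofTree → Position {Sg} → Subst Sg
      clauseSubst e v = θ ⊚ (matcher e v ⊚ renamingAt e v)

      clauseSubst-agrees : ∀ {e v x} → Placed e v → x occursInClause clause e →
                           clauseSubst e v x ≡ instantiation e x
      clauseSubst-agrees {e} {v} {x} s o =
        trans (restrict-absorbed θ θ-idempotent (renamingAt e v ⟪ Clause.head (clause e) ⟫) (ρ (index e ∷ v) x))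
              (θ-renamed s o)

      open Rew P (t ∷ []) θ ρ
      open RewFacts P (t ∷ []) θ ρ using (node-functional)

      t-ground : Ground t
      t-ground = subst Ground d-concl (wf-conclusion-ground d-wf)

      term-node   : ∀ {e v} → Placed e v → Node v (termL (conclusion e))
      clause-node : ∀ {e v} → Placed e v →
                    Node (index e ∷ v) (clauseL (applyClause (clauseSubst e v) (clause e)))
      term-node top =
        subst (λ u → Node goal-pos (termL u)) (trans (apply-ground θ t t-ground) (sym d-concl)) (goalChild here)
      term-node (down {e = e} {v = v} s q refl) with fit-premise (wf-premises (wf-at d-wf s)) q
      ... | _ , b , qb , concl =
        subst (λ u → Node _ (termL u))
          (trans (apply-cong b (λ x o → clauseSubst-agrees s (inj₂ (_ , b , qb , o)))) (sym concl))
          (bodyChild (clause-node s) (map-↦ (clauseSubst e v ⟪_⟫) qb))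
      clause-node s = matchChild (term-node s) (wf-index (wf-at d-wf s)) (head-matches s)

      clause-children : ∀ {e v j ℓ} → Placed e v → Node (j ∷ index e ∷ v) ℓ →
                        ∃ λ k → Placed k (j ∷ index e ∷ v)
      clause-children s (matchChild nd _ _) with node-functional nd (clause-node s)
      ... | ()
      clause-children s (noMatchChild nd _ _) with node-functional nd (clause-node s)
      ... | ()
      clause-children {e} {v} s (bodyChild nd q) with node-functional nd (clause-node s)
      ... | refl with map-↦⁻ (clauseSubst e v ⟪_⟫) (Clause.body (clause e)) q
      ...   | _ , qb , _ with fit-body (wf-premises (wf-at d-wf s)) qb
      ...     | k , qk = k , down s qk refl

      S : List (Position {Sg})
      S = [] ∷ positions d goal-pos

      true≢false : true ≡ false → ⊥
      true≢false ()

      atoms-not-adjacent : ∀ {e e′ v v′ j} → Placed e v → Placed e′ v′ → j ∷ v ≡ v′ → ⊥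
      atoms-not-adjacent s s′ refl = true≢false (trans (sym (cong not (placed-parity s))) (placed-parity s′))

      in-tree : ∀ w → w ∈ S → ∃ λ ℓ → Node w ℓ
      in-tree _ (here refl) = _ , root
      in-tree w (there m) with positions-inv d goal-pos m
      ... | _ , _ , s , inj₁ refl = _ , term-node s
      ... | _ , _ , s , inj₂ refl = _ , clause-node s

      connected : ∀ i w → (i ∷ w) ∈ S → w ∈ S
      connected i w (here ())
      connected i w (there m) with positions-inv d goal-pos m
      ... | _ , _ , s , inj₂ eq          = subst (_∈ S) (sym (∷-injectiveʳ eq)) (there (atom-position s))
      ... | _ , _ , top , inj₁ eq        = subst (_∈ S) (sym (∷-injectiveʳ eq)) (here refl)
      ... | _ , _ , down s _ refl , inj₁ eq = subst (_∈ S) (sym (∷-injectiveʳ eq)) (there (clause-position s))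

      or-all : ∀ w → w ∈ S → ev (length w) ≡ true → ∀ i ℓ → Node (i ∷ w) ℓ → (i ∷ w) ∈ S
      or-all _ (here refl) _ _ _ (goalChild here)       = there (atom-position {d} top)
      or-all _ (here refl) _ _ _ (goalChild (there ()))
      or-all _ (here refl) _ _ _ (matchChild () _ _)
      or-all _ (here refl) _ _ _ (noMatchChild () _ _)
      or-all _ (here refl) _ _ _ (bodyChild () _)
      or-all w (there m) w-even i ℓ nd with positions-inv d goal-pos m
      ... | _ , _ , s , inj₁ refl = ⊥-elim (true≢false (trans (sym w-even) (placed-parity s)))
      ... | _ , _ , s , inj₂ refl = there (atom-position (proj₂ (clause-children s nd)))

      and-one : ∀ w → w ∈ S → ev (length w) ≡ false →
                ∃ λ i → ((i ∷ w) ∈ S) × (∀ j → (j ∷ w) ∈ S → j ≡ i)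
      and-one _ (here refl) ()
      and-one w (there m) w-odd with positions-inv d goal-pos m
      ... | _ , _ , s , inj₂ refl = ⊥-elim (true≢false (trans (sym (cong not (placed-parity s))) w-odd))
      ... | e , v , s , inj₁ refl = index e , there (clause-position s) , only-clause
        where
          only-clause : ∀ j → (j ∷ v) ∈ S → j ≡ index e
          only-clause j (here ())
          only-clause j (there m′) with positions-inv d goal-pos m′
          ... | _ , _ , s′ , inj₁ eq = ⊥-elim (atoms-not-adjacent s s′ eq)
          ... | _ , _ , s′ , inj₂ eq with ∷-injective eq
          ...   | j≡ , v≡ = trans j≡ (cong index (sym (subtree-unique s s′ v≡)))

      leaves : ∀ w → w ∈ S → (∀ i → ¬ ((i ∷ w) ∈ S)) → InductiveSuccessNode w
      leaves _ (here refl) no-child = ⊥-elim (no-child 0 (there (atom-position {d} top)))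
      leaves w (there m) no-child with positions-inv d goal-pos m
      ... | e , _ , s , inj₁ refl = ⊥-elim (no-child (index e) (there (clause-position s)))
      ... | _ , _ , s , inj₂ refl =
        cong not (placed-parity s) , (_ , clause-node s , λ ()) ,
        λ i ℓ nd → no-child i (there (atom-position (proj₂ (clause-children s nd))))

      success-subtree : FiniteSuccessSubtree S
      success-subtree = record
        { hasRoot = here refl ; inTree = in-tree ; connected = connected
        ; orAll = or-all ; andOne = and-one ; leavesOk = leaves }

    completeness : t ∈M[ P ] → ∃ λ (θ : Subst Sg) → Idempotent θ × Grounding θ × IndSuccess P t θ ρ
    completeness t∈M with proof-tree t∈M
    ... | d , d-wf , d-concl = θ , θ-idempotent , θ-grounding , S , success-subtree
      where open Embedding d d-wf d-concl

theorem3p9 : (Sg : Signature) (P : Program Sg) (t : Term Sg)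
    (ρ : Renaming {Sg}) → RenamedApart t ρ →
    ((σ : Subst Sg) → Idempotent σ → IndSuccess P t σ ρ →
      (t′ : Term Sg) → Ground t′ → (∃ λ τ → τ ⟪ σ ⟪ t ⟫ ⟫ ≡ t′) →
      t′ ∈M[ P ])
    ×
    (t ∈M[ P ] →
      ∃ λ (θ : Subst Sg) → Idempotent θ × Grounding θ × IndSuccess P t θ ρ)
theorem3p9 Sg P t ρ (ρ-injective , _) = inductive-soundness , Completeness.completeness P ρ ρ-injective t
  where
    open Theory Sg

    inductive-soundness : (σ : Subst Sg) → Idempotent σ → IndSuccess P t σ ρ →
                          (t′ : Term Sg) → Ground t′ → (∃ λ τ → τ ⟪ σ ⟪ t ⟫ ⟫ ≡ t′) → t′ ∈M[ P ]
    inductive-soundness σ σ-idem success t′ t′-ground (τ , refl) =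
      Soundness.soundness P t σ ρ σ-idem success τ t′-ground
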